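{- The CPS language is closed under $\to_n$: if $M$ belongs to the CPS language (i.e. is generated by one of the nonterminals $V$, $K$, $A$ below) and $M\to_nN$, then $N$ belongs to the CPS language.
   Context: Call-by-name $\lambda\Box$-calculus. Terms are $c\mid x\mid\lambda x.M\mid MM\mid\mathbf{box}_{x_1,\dots,x_n}(N_1,\dots,N_n;M)$. The $x_i$ are bound in $M$, and the free variables of a box term are those of the $N_i$. $\to_n$ is the closure under term contexts of: - $(\lambda x.M)N\to M[x:=N]$; - $\lambda x.Mx\to M$ ($x\notin FV(M)$); - $\mathbf{box}_x(M;x)\to M$; - $\mathbf{box}_{\vec w,x,\vec z}(\vec P,\mathbf{box}_{\vec y}(\vec L;N),\vec Q;M)\to\mathbf{box}_{\vec w,\vec y,\vec z}(\vec P,\vec L,\vec Q;M[x:=N])$ with $|\vec w|=|\vec P|$. The CPS language is the subset of call-by-name terms generated by the grammar below, where $k$ ranges over a distinguished class of continuation variables, $x$ over ordinary variables, and $c$ over constants: - $V::=c\mid x\mid\lambda k.K\mid\mathbf{box}_{x_1,\dots,x_n}(V_1,\dots,V_n;V)$; - $K::=k\mid\lambda x.A\mid VK$; - $A::=KV\mid(\lambda k.A)K$. -}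

module Defs where

open import Data.Nat using (ℕ)
open import Data.List using (List; []; _∷_; _++_)
open import Data.List.Relation.Unary.All using (All)
open import Data.Sum using (_⊎_)
open import Relation.Binary.PropositionalEquality using (_≡_)

-- Variables come in two classes: continuation variables (κ) and
-- ordinary variables (ι).  Terms are intrinsically well-scoped
-- (de Bruijn indices), each variable carrying its class.

data Sort : Set where
  κ ι : Sort

Ctx : Set
Ctx = List Sort

data Var : Ctx → Sort → Set where
  here  : ∀ {Γ s} → Var (s ∷ Γ) s
  there : ∀ {Γ s t} → Var Γ s → Var (t ∷ Γ) s

-- Constants are represented by natural numbers.
-- box Δ Ns M  is  box_{x_1..x_n}(N_1..N_n ; M) where Δ lists the
-- classes of the bound x_i, Ns the N_i (in context Γ) and M lives in
-- the context Δ only (the free variables of M are among the x_i; the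
-- free variables of the box term are those of the N_i).
mutual
  data Term : Ctx → Set where
    con : ∀ {Γ} → ℕ → Term Γ
    var : ∀ {Γ s} → Var Γ s → Term Γ
    lam : ∀ {Γ} (s : Sort) → Term (s ∷ Γ) → Term Γ
    app : ∀ {Γ} → Term Γ → Term Γ → Term Γ
    box : ∀ {Γ} (Δ : Ctx) → Args Γ Δ → Term Δ → Term Γ

  data Args (Γ : Ctx) : Ctx → Set where
    []  : Args Γ []
    _∷_ : ∀ {s Δ} → Term Γ → Args Γ Δ → Args Γ (s ∷ Δ)

infixr 5 _++ᵃ_
_++ᵃ_ : ∀ {Γ Δ₁ Δ₂} → Args Γ Δ₁ → Args Γ Δ₂ → Args Γ (Δ₁ ++ Δ₂)
[] ++ᵃ bs = bs
(a ∷ as) ++ᵃ bs = a ∷ (as ++ᵃ bs)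

Ren : Ctx → Ctx → Set
Ren Γ Δ = ∀ {s} → Var Γ s → Var Δ s

ext : ∀ {Γ Δ t} → Ren Γ Δ → Ren (t ∷ Γ) (t ∷ Δ)
ext ρ here = here
ext ρ (there x) = there (ρ x)

mutual
  rename : ∀ {Γ Δ} → Ren Γ Δ → Term Γ → Term Δ
  rename ρ (con c) = con c
  rename ρ (var x) = var (ρ x)
  rename ρ (lam s M) = lam s (rename (ext ρ) M)
  rename ρ (app M N) = app (rename ρ M) (rename ρ N)
  rename ρ (box Θ Ns M) = box Θ (renameArgs ρ Ns) M

  renameArgs : ∀ {Γ Δ Θ} → Ren Γ Δ → Args Γ Θ → Args Δ Θ
  renameArgs ρ [] = []
  renameArgs ρ (N ∷ Ns) = rename ρ N ∷ renameArgs ρ Ns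

Sub : Ctx → Ctx → Set
Sub Γ Δ = ∀ {s} → Var Γ s → Term Δ

exts : ∀ {Γ Δ t} → Sub Γ Δ → Sub (t ∷ Γ) (t ∷ Δ)
exts σ here = var here
exts σ (there x) = rename there (σ x)

mutual
  subst : ∀ {Γ Δ} → Sub Γ Δ → Term Γ → Term Δ
  subst σ (con c) = con c
  subst σ (var x) = σ x
  subst σ (lam s M) = lam s (subst (exts σ) M)
  subst σ (app M N) = app (subst σ M) (subst σ N)
  subst σ (box Θ Ns M) = box Θ (substArgs σ Ns) M

  substArgs : ∀ {Γ Δ Θ} → Sub Γ Δ → Args Γ Θ → Args Δ Θ
  substArgs σ [] = []
  substArgs σ (N ∷ Ns) = subst σ N ∷ substArgs σ Ns

singleSub : ∀ {Γ s} → Term Γ → Sub (s ∷ Γ) Γ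
singleSub N here = N
singleSub N (there x) = var x

_[_] : ∀ {Γ s} → Term (s ∷ Γ) → Term Γ → Term Γ
M [ N ] = subst (singleSub N) M

injˡ : ∀ {Θ s} (Δ : Ctx) → Var Δ s → Var (Δ ++ Θ) s
injˡ (_ ∷ Δ) here = here
injˡ (_ ∷ Δ) (there x) = there (injˡ Δ x)

raise : ∀ {Θ s} (Δ : Ctx) → Var Θ s → Var (Δ ++ Θ) s
raise [] x = x
raise (_ ∷ Δ) x = there (raise Δ x)

-- The substitution [x:=N] from context  ws , x , zs  to  ws , ys , zs
-- (N lives in context ys), the other variables being kept.
boxSub : ∀ {t} (ws ys zs : Ctx) → Term ys → Sub (ws ++ t ∷ zs) (ws ++ ys ++ zs)
boxSub [] ys zs N here = rename (injˡ ys) N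
boxSub [] ys zs N (there x) = var (raise ys x)
boxSub (_ ∷ ws) ys zs N here = var here
boxSub (_ ∷ ws) ys zs N (there x) = rename there (boxSub ws ys zs N x)

infix 4 _⟶_ _⟶ᵃ_
mutual
  data _⟶_ : ∀ {Γ} → Term Γ → Term Γ → Set where
    β : ∀ {Γ s} (M : Term (s ∷ Γ)) (N : Term Γ) →
        app (lam s M) N ⟶ M [ N ]
    η : ∀ {Γ s} (M : Term Γ) →
        lam s (app (rename there M) (var here)) ⟶ M
    box-id : ∀ {Γ s} (M : Term Γ) →
        box (s ∷ []) (M ∷ []) (var here) ⟶ M
    box-box : ∀ {Γ t} (ws ys zs : Ctx)
        (P : Args Γ ws) (L : Args Γ ys) (N : Term ys) (Q : Args Γ zs)
        (M : Term (ws ++ t ∷ zs)) →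
        box (ws ++ t ∷ zs) (P ++ᵃ (box ys L N ∷ Q)) M
          ⟶ box (ws ++ ys ++ zs) (P ++ᵃ (L ++ᵃ Q)) (subst (boxSub ws ys zs N) M)
    ξ-lam : ∀ {Γ s} {M M' : Term (s ∷ Γ)} → M ⟶ M' → lam s M ⟶ lam s M'
    ξ-appˡ : ∀ {Γ} {M M' N : Term Γ} → M ⟶ M' → app M N ⟶ app M' N
    ξ-appʳ : ∀ {Γ} {M N N' : Term Γ} → N ⟶ N' → app M N ⟶ app M N'
    ξ-box-args : ∀ {Γ Δ} {Ns Ns' : Args Γ Δ} {M : Term Δ} →
        Ns ⟶ᵃ Ns' → box Δ Ns M ⟶ box Δ Ns' M
    ξ-box-body : ∀ {Γ Δ} {Ns : Args Γ Δ} {M M' : Term Δ} →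
        M ⟶ M' → box Δ Ns M ⟶ box Δ Ns M'

  data _⟶ᵃ_ {Γ : Ctx} : ∀ {Δ} → Args Γ Δ → Args Γ Δ → Set where
    here  : ∀ {s Δ} {N N' : Term Γ} {Ns : Args Γ Δ} →
        N ⟶ N' → _⟶ᵃ_ {Δ = s ∷ Δ} (N ∷ Ns) (N' ∷ Ns)
    there : ∀ {s Δ} {N : Term Γ} {Ns Ns' : Args Γ Δ} →
        Ns ⟶ᵃ Ns' → _⟶ᵃ_ {Δ = s ∷ Δ} (N ∷ Ns) (N ∷ Ns')

-- The CPS language
--   V ::= c | x | λk.K | box_{x1..xn}(V1..Vn ; V)
--   K ::= k | λx.A | V K
--   A ::= K V | (λk.A) K
-- (k continuation variables, x ordinary variables)

mutual
  data IsV : ∀ {Γ} → Term Γ → Set where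
    v-con : ∀ {Γ} (c : ℕ) → IsV {Γ} (con c)
    v-var : ∀ {Γ} (x : Var Γ ι) → IsV (var x)
    v-lam : ∀ {Γ} {K : Term (κ ∷ Γ)} → IsK K → IsV (lam κ K)
    v-box : ∀ {Γ Δ} {Vs : Args Γ Δ} {V : Term Δ} →
        All (_≡ ι) Δ → IsVArgs Vs → IsV V → IsV (box Δ Vs V)

  data IsVArgs {Γ : Ctx} : ∀ {Δ} → Args Γ Δ → Set where
    []  : IsVArgs []
    _∷_ : ∀ {s Δ} {V : Term Γ} {Vs : Args Γ Δ} →
        IsV V → IsVArgs Vs → IsVArgs {Δ = s ∷ Δ} (V ∷ Vs)

  data IsK : ∀ {Γ} → Term Γ → Set where
    k-var : ∀ {Γ} (k : Var Γ κ) → IsK (var k)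
    k-lam : ∀ {Γ} {A : Term (ι ∷ Γ)} → IsA A → IsK (lam ι A)
    k-app : ∀ {Γ} {V K : Term Γ} → IsV V → IsK K → IsK (app V K)

  data IsA : ∀ {Γ} → Term Γ → Set where
    a-app : ∀ {Γ} {K V : Term Γ} → IsK K → IsV V → IsA (app K V)
    a-redex : ∀ {Γ} {A : Term (κ ∷ Γ)} {K : Term Γ} →
        IsA A → IsK K → IsA (app (lam κ A) K)

CPS : ∀ {Γ} → Term Γ → Set
CPS M = IsV M ⊎ IsK M ⊎ IsA M

module Submission where

-- Every rule respects variable classes: β substitutes a V for an
-- ordinary variable ((λx.A)V) or a K for a continuation variable
-- ((λk.K')K and (λk.A)K), and box-box substitutes a value into a value
-- body whose binders are all ordinary; so the core is a substitution
-- lemma for class-respecting substitutions.  For η-contraction of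
-- λy.M y, the class of the body M y together with the sort of y forces
-- M into the class the contractum needs, and the classes are reflected
-- by the weakening that M undergoes under the binder.

open import Defs
open import Data.List using ([]; _∷_; _++_)
open import Data.List.Relation.Unary.All using (All; _∷_)
open import Data.List.Relation.Unary.All.Properties using (++⁺; ++⁻ˡ; ++⁻ʳ)
open import Data.Product using (_×_; _,_)
open import Data.Sum using (_⊎_; inj₁; inj₂)
open import Relation.Binary.PropositionalEquality using (_≡_; refl)

-- The class a term must belong to in order to replace a variable of a sort.
IsOfSort : ∀ {Γ} → Sort → Term Γ → Set
IsOfSort ι T = IsV T
IsOfSort κ T = IsK T

var-IsOfSort : ∀ {Γ s} (x : Var Γ s) → IsOfSort s (var x)
var-IsOfSort {s = ι} x = v-var x
var-IsOfSort {s = κ} x = k-var x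

data IsLamA {Γ} : Term Γ → Set where
  lam-A : ∀ {A} → IsA A → IsLamA (lam κ A)

IsA-app⁻ : ∀ {Γ} {T U : Term Γ} → IsA (app T U) → (IsK T × IsV U) ⊎ (IsLamA T × IsK U)
IsA-app⁻ (a-app k v) = inj₁ (k , v)
IsA-app⁻ (a-redex a k) = inj₂ (lam-A a , k)

IsA-redex : ∀ {Γ} {T U : Term Γ} → IsLamA T → IsK U → IsA (app T U)
IsA-redex (lam-A a) k = a-redex a k

mutual
  IsV-rename⁺ : ∀ {Γ Δ} (ρ : Ren Γ Δ) {M : Term Γ} → IsV M → IsV (rename ρ M)
  IsV-rename⁺ ρ (v-con c) = v-con c
  IsV-rename⁺ ρ (v-var x) = v-var (ρ x)
  IsV-rename⁺ ρ (v-lam k) = v-lam (IsK-rename⁺ (ext ρ) k)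
  IsV-rename⁺ ρ (v-box al vs v) = v-box al (IsVArgs-rename⁺ ρ vs) v

  IsVArgs-rename⁺ : ∀ {Γ Δ Θ} (ρ : Ren Γ Δ) {Ns : Args Γ Θ} →
                    IsVArgs Ns → IsVArgs (renameArgs ρ Ns)
  IsVArgs-rename⁺ ρ [] = []
  IsVArgs-rename⁺ ρ (v ∷ vs) = IsV-rename⁺ ρ v ∷ IsVArgs-rename⁺ ρ vs

  IsK-rename⁺ : ∀ {Γ Δ} (ρ : Ren Γ Δ) {M : Term Γ} → IsK M → IsK (rename ρ M)
  IsK-rename⁺ ρ (k-var k) = k-var (ρ k)
  IsK-rename⁺ ρ (k-lam a) = k-lam (IsA-rename⁺ (ext ρ) a)
  IsK-rename⁺ ρ (k-app v k) = k-app (IsV-rename⁺ ρ v) (IsK-rename⁺ ρ k)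

  IsA-rename⁺ : ∀ {Γ Δ} (ρ : Ren Γ Δ) {M : Term Γ} → IsA M → IsA (rename ρ M)
  IsA-rename⁺ ρ (a-app k v) = a-app (IsK-rename⁺ ρ k) (IsV-rename⁺ ρ v)
  IsA-rename⁺ ρ (a-redex a k) = a-redex (IsA-rename⁺ (ext ρ) a) (IsK-rename⁺ ρ k)

IsOfSort-rename⁺ : ∀ {Γ Δ} s (ρ : Ren Γ Δ) {M : Term Γ} →
                   IsOfSort s M → IsOfSort s (rename ρ M)
IsOfSort-rename⁺ ι ρ v = IsV-rename⁺ ρ v
IsOfSort-rename⁺ κ ρ k = IsK-rename⁺ ρ k

mutual
  IsV-rename⁻ : ∀ {Γ Δ} (ρ : Ren Γ Δ) (M : Term Γ) → IsV (rename ρ M) → IsV M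
  IsV-rename⁻ ρ (con c) _ = v-con c
  IsV-rename⁻ ρ (var x) (v-var _) = v-var x
  IsV-rename⁻ ρ (lam κ M) (v-lam k) = v-lam (IsK-rename⁻ (ext ρ) M k)
  IsV-rename⁻ ρ (box Θ Ns M) (v-box al vs v) = v-box al (IsVArgs-rename⁻ ρ Ns vs) v

  IsVArgs-rename⁻ : ∀ {Γ Δ Θ} (ρ : Ren Γ Δ) (Ns : Args Γ Θ) →
                    IsVArgs (renameArgs ρ Ns) → IsVArgs Ns
  IsVArgs-rename⁻ ρ [] _ = []
  IsVArgs-rename⁻ ρ (N ∷ Ns) (v ∷ vs) = IsV-rename⁻ ρ N v ∷ IsVArgs-rename⁻ ρ Ns vs

  IsK-rename⁻ : ∀ {Γ Δ} (ρ : Ren Γ Δ) (M : Term Γ) → IsK (rename ρ M) → IsK M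
  IsK-rename⁻ ρ (var x) (k-var _) = k-var x
  IsK-rename⁻ ρ (lam ι M) (k-lam a) = k-lam (IsA-rename⁻ (ext ρ) M a)
  IsK-rename⁻ ρ (app M N) (k-app v k) = k-app (IsV-rename⁻ ρ M v) (IsK-rename⁻ ρ N k)

  IsA-rename⁻ : ∀ {Γ Δ} (ρ : Ren Γ Δ) (M : Term Γ) → IsA (rename ρ M) → IsA M
  IsA-rename⁻ ρ (app M N) a with IsA-app⁻ a
  ... | inj₁ (k , v) = a-app (IsK-rename⁻ ρ M k) (IsV-rename⁻ ρ N v)
  ... | inj₂ (la , k) = IsA-redex (IsLamA-rename⁻ ρ M la) (IsK-rename⁻ ρ N k)

  IsLamA-rename⁻ : ∀ {Γ Δ} (ρ : Ren Γ Δ) (M : Term Γ) → IsLamA (rename ρ M) → IsLamA M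
  IsLamA-rename⁻ ρ (lam κ A) (lam-A a) = lam-A (IsA-rename⁻ (ext ρ) A a)

IsCPSSub : ∀ {Γ Δ} → Sub Γ Δ → Set
IsCPSSub {Γ} σ = ∀ {s} (x : Var Γ s) → IsOfSort s (σ x)

exts-IsCPSSub : ∀ {Γ Δ t} {σ : Sub Γ Δ} → IsCPSSub σ → IsCPSSub (exts {t = t} σ)
exts-IsCPSSub g here = var-IsOfSort here
exts-IsCPSSub g {s} (there x) = IsOfSort-rename⁺ s there (g x)

singleSub-IsCPSSub : ∀ {Γ s} {N : Term Γ} → IsOfSort s N → IsCPSSub (singleSub {s = s} N)
singleSub-IsCPSSub n here = n
singleSub-IsCPSSub n (there x) = var-IsOfSort x

mutual
  IsV-subst : ∀ {Γ Δ} {σ : Sub Γ Δ} → IsCPSSub σ → {M : Term Γ} → IsV M → IsV (subst σ M)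
  IsV-subst g (v-con c) = v-con c
  IsV-subst g (v-var x) = g x
  IsV-subst g (v-lam k) = v-lam (IsK-subst (exts-IsCPSSub g) k)
  IsV-subst g (v-box al vs v) = v-box al (IsVArgs-subst g vs) v

  IsVArgs-subst : ∀ {Γ Δ Θ} {σ : Sub Γ Δ} → IsCPSSub σ → {Ns : Args Γ Θ} →
                  IsVArgs Ns → IsVArgs (substArgs σ Ns)
  IsVArgs-subst g [] = []
  IsVArgs-subst g (v ∷ vs) = IsV-subst g v ∷ IsVArgs-subst g vs

  IsK-subst : ∀ {Γ Δ} {σ : Sub Γ Δ} → IsCPSSub σ → {M : Term Γ} → IsK M → IsK (subst σ M)
  IsK-subst g (k-var k) = g k
  IsK-subst g (k-lam a) = k-lam (IsA-subst (exts-IsCPSSub g) a)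
  IsK-subst g (k-app v k) = k-app (IsV-subst g v) (IsK-subst g k)

  IsA-subst : ∀ {Γ Δ} {σ : Sub Γ Δ} → IsCPSSub σ → {M : Term Γ} → IsA M → IsA (subst σ M)
  IsA-subst g (a-app k v) = a-app (IsK-subst g k) (IsV-subst g v)
  IsA-subst g (a-redex a k) = a-redex (IsA-subst (exts-IsCPSSub g) a) (IsK-subst g k)

IsVArgs-head : ∀ {Γ s Δ} {N : Term Γ} {Ns : Args Γ Δ} → IsVArgs {Δ = s ∷ Δ} (N ∷ Ns) → IsV N
IsVArgs-head (v ∷ _) = v

IsVArgs-++⁺ : ∀ {Γ Δ₁ Δ₂} {P : Args Γ Δ₁} {R : Args Γ Δ₂} →
              IsVArgs P → IsVArgs R → IsVArgs (P ++ᵃ R)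
IsVArgs-++⁺ [] r = r
IsVArgs-++⁺ (v ∷ p) r = v ∷ IsVArgs-++⁺ p r

IsVArgs-++⁻ : ∀ {Γ Δ₁ Δ₂} (P : Args Γ Δ₁) {R : Args Γ Δ₂} →
              IsVArgs (P ++ᵃ R) → IsVArgs P × IsVArgs R
IsVArgs-++⁻ [] vs = [] , vs
IsVArgs-++⁻ (N ∷ P) (v ∷ vs) with IsVArgs-++⁻ P vs
... | p , r = v ∷ p , r

sort≡ι : ∀ {Γ s} → All (_≡ ι) Γ → Var Γ s → s ≡ ι
sort≡ι (p ∷ _) here = p
sort≡ι (_ ∷ ps) (there x) = sort≡ι ps x

boxSub-IsV : ∀ {t} (ws ys zs : Ctx) {N : Term ys} → IsV N →
             (x : Var (ws ++ t ∷ zs) ι) → IsV (boxSub ws ys zs N x)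
boxSub-IsV [] ys zs n here = IsV-rename⁺ (injˡ ys) n
boxSub-IsV [] ys zs n (there x) = v-var (raise ys x)
boxSub-IsV (_ ∷ ws) ys zs n here = v-var here
boxSub-IsV (_ ∷ ws) ys zs n (there x) = IsV-rename⁺ there (boxSub-IsV ws ys zs n x)

boxSub-IsCPSSub : ∀ {t} (ws ys zs : Ctx) {N : Term ys} → IsV N →
                  All (_≡ ι) (ws ++ t ∷ zs) → IsCPSSub (boxSub ws ys zs N)
boxSub-IsCPSSub ws ys zs n al x with sort≡ι al x
... | refl = boxSub-IsV ws ys zs n x

mutual
  IsV-⟶ : ∀ {Γ} {M N : Term Γ} → IsV M → M ⟶ N → IsV N
  IsV-⟶ (v-lam (k-app v _)) (η M) = IsV-rename⁻ there M v
  IsV-⟶ (v-lam k) (ξ-lam r) = v-lam (IsK-⟶ k r)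
  IsV-⟶ (v-box al vs v) r = IsV-box-⟶ al vs v r

  IsV-box-⟶ : ∀ {Γ Δ} {Vs : Args Γ Δ} {V : Term Δ} {N : Term Γ} →
              All (_≡ ι) Δ → IsVArgs Vs → IsV V → box Δ Vs V ⟶ N → IsV N
  IsV-box-⟶ al vs _ (box-id M) = IsVArgs-head vs
  IsV-box-⟶ al vs v (box-box ws ys zs P L N Q M)
    with IsVArgs-++⁻ P vs | ++⁻ˡ ws al | ++⁻ʳ ws al
  ... | vp , (v-box aly vl vn ∷ vq) | alw | _ ∷ alz =
    v-box (++⁺ alw (++⁺ aly alz))
          (IsVArgs-++⁺ vp (IsVArgs-++⁺ vl vq))
          (IsV-subst (boxSub-IsCPSSub ws ys zs vn al) v)
  IsV-box-⟶ al vs v (ξ-box-args r) = v-box al (IsVArgs-⟶ vs r) v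
  IsV-box-⟶ al vs v (ξ-box-body r) = v-box al vs (IsV-⟶ v r)

  IsVArgs-⟶ : ∀ {Γ Δ} {Ns Ns' : Args Γ Δ} → IsVArgs Ns → Ns ⟶ᵃ Ns' → IsVArgs Ns'
  IsVArgs-⟶ (v ∷ vs) (here r) = IsV-⟶ v r ∷ vs
  IsVArgs-⟶ (v ∷ vs) (there r) = v ∷ IsVArgs-⟶ vs r

  IsK-⟶ : ∀ {Γ} {M N : Term Γ} → IsK M → M ⟶ N → IsK N
  IsK-⟶ (k-lam a) (η M) with IsA-app⁻ a
  ... | inj₁ (k , _) = IsK-rename⁻ there M k
  ... | inj₂ (_ , ())
  IsK-⟶ (k-lam a) (ξ-lam r) = k-lam (IsA-⟶ a r)
  IsK-⟶ (k-app (v-lam k') k) (β M N) = IsK-subst (singleSub-IsCPSSub k) k'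
  IsK-⟶ (k-app v k) (ξ-appˡ r) = k-app (IsV-⟶ v r) k
  IsK-⟶ (k-app v k) (ξ-appʳ r) = k-app v (IsK-⟶ k r)

  IsLamA-⟶ : ∀ {Γ} {M N : Term Γ} → IsLamA M → M ⟶ N → IsLamA N
  IsLamA-⟶ (lam-A a) (η M) with IsA-app⁻ a
  ... | inj₁ (_ , ())
  ... | inj₂ (la , _) = IsLamA-rename⁻ there M la
  IsLamA-⟶ (lam-A a) (ξ-lam r) = lam-A (IsA-⟶ a r)

  IsA-⟶ : ∀ {Γ} {M N : Term Γ} → IsA M → M ⟶ N → IsA N
  IsA-⟶ (a-app (k-lam a) v) (β M N) = IsA-subst (singleSub-IsCPSSub v) a
  IsA-⟶ (a-redex a k) (β M N) = IsA-subst (singleSub-IsCPSSub k) a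
  IsA-⟶ (a-app k v) (ξ-appˡ r) = a-app (IsK-⟶ k r) v
  IsA-⟶ (a-app k v) (ξ-appʳ r) = a-app k (IsV-⟶ v r)
  IsA-⟶ (a-redex a k) (ξ-appˡ r) = IsA-redex (IsLamA-⟶ (lam-A a) r) k
  IsA-⟶ (a-redex a k) (ξ-appʳ r) = a-redex a (IsK-⟶ k r)

proposition6 : ∀ {Γ : Ctx} (M N : Term Γ) → CPS M → M ⟶ N → CPS N
proposition6 M N (inj₁ v) r = inj₁ (IsV-⟶ v r)
proposition6 M N (inj₂ (inj₁ k)) r = inj₂ (inj₁ (IsK-⟶ k r))
proposition6 M N (inj₂ (inj₂ a)) r = inj₂ (inj₂ (IsA-⟶ a r))
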